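{- Let $d > 2$, let $k, n$ be positive integers, and let $T \subseteq [k]^d$ be a magic set of cardinality $nk$. Then for every partial Latin hypercube $C$ of length $k$ and type $T$, $$\mathrm{sgn}_1(C)^{d-1}\,\mathrm{sgn}_2(C)\cdots\mathrm{sgn}_d(C)\,\mathrm{ssgn}(C) = \mathrm{sgn}(T).$$
   Context: Elements of $[k]^d$ are called cells and are ordered lexicographically. A slice in direction $\ell \in [d]$ is the set of cells with a fixed $\ell$-th coordinate. A magic set is a subset $T \subseteq [k]^d$ having the same number of elements in every slice; if $|T| = nk$ this number is $n$. A partial Latin hypercube of length $k$ and type $T$ is a function $C:[k]^d \to \{0,1,\ldots,n\}$ with $C(a) \neq 0$ exactly for $a \in T$, such that for each slice $A$, the nonzero values $C(a)$, $a\in A$, listed in lexicographic order of $a$, form a permutation of $[n]$ (the $C$-permutation of $A$). $\mathrm{sgn}_\ell(C)$ is the product of the signs of the $C$-permutations of the $k$ slices in direction $\ell$. For each $i \in [n]$, the set $\{a : C(a) = i\}$ meets every slice exactly once, hence equals $\{(j, \pi_2(j), \ldots, \pi_d(j)) : j \in [k]\}$ for unique permutations $\pi_2,\ldots,\pi_d$ of $[k]$; the subsign of $i$ is $\mathrm{sgn}(\pi_2)\cdots\mathrm{sgn}(\pi_d)$, and $\mathrm{ssgn}(C)$ is the product of the subsigns over $i \in [n]$. For a sequence $a = (a_1,\ldots,a_N)$ of integers, $\mathrm{msgn}(a) := (-1)^{\#\{(i,j): i<j,\ a_i > a_j\}}$. If $x_1 < \cdots < x_{nk}$ are the elements of $T$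 in lexicographic order with $x_i = (x_i^{(1)},\ldots,x_i^{(d)})$, set $T_\ell := (x_1^{(\ell)},\ldots,x_{nk}^{(\ell)})$ and $\mathrm{sgn}(T) := \mathrm{msgn}(T_1)\cdots\mathrm{msgn}(T_d)$. -}

module Defs where

open import Data.Nat using (ℕ; zero; suc; _+_; _*_; _<_; _<ᵇ_; _≡ᵇ_)
open import Data.Fin using (Fin; toℕ)
open import Data.Bool using (Bool; true; false; if_then_else_; not)
open import Data.List using (List; []; _∷_; map; filter; concatMap; length; foldr; allFin; upTo)
open import Data.List.Relation.Binary.Permutation.Propositional using (_↭_)
open import Data.Vec using (Vec; []; _∷_; lookup)
open import Data.Sign using (Sign) renaming (_*_ to _·_)
open import Relation.Binary.PropositionalEquality using (_≡_; _≢_)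
open import Relation.Nullary.Decidable using (does)
open import Data.Fin using (_≟_)
import Data.Nat as ℕ
open import Data.Product using (_×_)

-- Cells of [k]^d (coordinates 0..k-1, directions 0..d-1)
Cell : ℕ → ℕ → Set
Cell k d = Vec (Fin k) d

allCells : (k d : ℕ) → List (Cell k d)
allCells k zero = [] ∷ []
allCells k (suc d) = concatMap (λ i → map (i ∷_) (allCells k d)) (allFin k)

filterᵇ : {A : Set} → (A → Bool) → List A → List A
filterᵇ p [] = []
filterᵇ p (x ∷ xs) = if p x then x ∷ filterᵇ p xs else filterᵇ p xs

sliceCells : {k d : ℕ} → Fin d → Fin k → List (Cell k d)
sliceCells {k} {d} ℓ j = filterᵇ (λ a → does (lookup a ℓ ≟ j)) (allCells k d)

Subset : ℕ → ℕ → Set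
Subset k d = Cell k d → Bool

IsMagic : {k d : ℕ} → ℕ → Subset k d → Set
IsMagic {k} {d} n T = (ℓ : Fin d) (j : Fin k) → length (filterᵇ T (sliceCells ℓ j)) ≡ n

card : {k d : ℕ} → Subset k d → ℕ
card {k} {d} T = length (filterᵇ T (allCells k d))

inversions : List ℕ → ℕ
inversions [] = 0
inversions (x ∷ xs) = length (filterᵇ (λ y → y <ᵇ x) xs) + inversions xs

signPow : ℕ → Sign
signPow zero = Sign.+
signPow (suc m) = Sign.- · signPow m

msgn : List ℕ → Sign
msgn xs = signPow (inversions xs)

prodSign : List Sign → Sign
prodSign = foldr _·_ Sign.+

isNonzero : ℕ → Bool
isNonzero zero = false
isNonzero (suc _) = true

IsPLH : {k d : ℕ} → ℕ → Subset k d → (Cell k d → ℕ) → Set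
IsPLH {k} {d} n T C =
  ((a : Cell k d) → isNonzero (C a) ≡ T a) ×
  ((ℓ : Fin d) (j : Fin k) →
     filterᵇ isNonzero (map C (sliceCells ℓ j)) ↭ map suc (upTo n))

cPerm : {k d : ℕ} → (Cell k d → ℕ) → Fin d → Fin k → List ℕ
cPerm C ℓ j = filterᵇ isNonzero (map C (sliceCells ℓ j))

sgnDir : {k d : ℕ} → (Cell k d → ℕ) → Fin d → Sign
sgnDir {k} C ℓ = prodSign (map (λ j → msgn (cPerm C ℓ j)) (allFin k))

-- directions 2..d (0-indexed: all ℓ except the first)
laterDirs : (d : ℕ) → List (Fin d)
laterDirs d = filterᵇ (λ ℓ → not (toℕ ℓ ≡ᵇ 0)) (allFin d)

-- subsign of the value i: the cells with C a = i, listed in lexicographic order,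
-- are (j, π₂ j, …, π_d j) for j = 1..k; sgn(π_m) = msgn of their m-th coordinates
subsign : {k d : ℕ} → (Cell k d → ℕ) → ℕ → Sign
subsign {k} {d} C i =
  prodSign (map (λ m → msgn (map (λ a → toℕ (lookup a m)) level)) (laterDirs d))
  where
  level = filterᵇ (λ a → C a ≡ᵇ i) (allCells k d)

ssgn : {k d : ℕ} → ℕ → (Cell k d → ℕ) → Sign
ssgn n C = prodSign (map (λ i → subsign C (suc i)) (upTo n))

sgnT : {k d : ℕ} → Subset k d → Sign
sgnT {k} {d} T =
  prodSign (map (λ ℓ → msgn (map (λ a → toℕ (lookup a ℓ)) (filterᵇ T (allCells k d)))) (allFin d))

signPowS : Sign → ℕ → Sign
signPowS s zero = Sign.+
signPowS s (suc e) = s · signPowS s e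

-- sgn_1(C): the direction with index 0 (the paper's direction 1); for d ≥ 1 this list has exactly one entry
sgnFirst : {k d : ℕ} → (Cell k d → ℕ) → Sign
sgnFirst {k} {d} C = prodSign (map (sgnDir C) (filterᵇ (λ ℓ → toℕ ℓ ≡ᵇ 0) (allFin d)))

-- Every sign in the identity is a product, over the pairs x < y of cells in
-- lexicographic order, of an elementary sign depending only on the entries
-- p = C x, q = C y and on the coordinates u, v of x, y in one direction ℓ.
-- Comparing p with q and u with v case by case gives, for every direction ℓ,
--   (inversions of C inside ℓ-slices) · (ℓ-inversions inside levels of C)
--     = (ℓ-inversions of T) · (discordant pairs) · (inversions of C),
-- where a pair is discordant when entries and ℓ-coordinates are in opposite
-- order.  By the Latin property the number of discordant pairs can be counted
-- slice by slice, which gives an expression not involving ℓ.  In the first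
-- direction the cells are already sorted, so there the ℓ-inversions vanish and
-- sgn₁(C) is the product of the last two signs; multiplying the identities for
-- the other d - 1 directions yields the theorem.
module Submission where

open import Defs
open import Algebra.Bundles using (CommutativeMonoid)
open import Data.Bool using (Bool; true; false; _∧_; if_then_else_)
open import Data.Bool.Properties using (∧-zeroʳ)
open import Data.Fin as Fin using (Fin; toℕ; _≟_)
open import Data.List using (List; []; _∷_; map; length; allFin; upTo; tabulate)
open import Data.List.Membership.Propositional using (_∈_)
open import Data.List.Membership.Propositional.Properties
  using (∈-map⁺; ∈-map⁻; ∈-concat⁺′; ∈-allFin; ∈-upTo⁺; ∈-upTo⁻)
open import Data.List.Properties using (map-∘; map-cong; length-tabulate)
open import Data.List.Relation.Binary.Permutation.Propositional using (_↭_; ↭⇒↭ₛ)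
open import Data.List.Relation.Binary.Permutation.Propositional.Properties
  using (∈-resp-↭) renaming (map⁺ to ↭-map⁺)
open import Data.List.Relation.Binary.Permutation.Setoid.Properties using (foldr-commMonoid)
open import Data.List.Relation.Unary.All as All using (All; []; _∷_)
import Data.List.Relation.Unary.All.Properties as All
open import Data.List.Relation.Unary.AllPairs as AllPairs using (AllPairs; []; _∷_)
import Data.List.Relation.Unary.AllPairs.Properties as AllPairs
open import Data.List.Relation.Unary.Any using (here; there)
open import Data.List.Relation.Unary.Unique.Propositional using (Unique)
open import Data.List.Relation.Unary.Unique.Propositional.Properties using (allFin⁺; upTo⁺)
open import Data.Nat using (ℕ; zero; suc; _+_; _*_; _∸_; _≤_; _<_; _<ᵇ_; _≡ᵇ_; _<?_; z≤n)
import Data.Nat as ℕ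
open import Data.Nat.Properties using (≤-refl; <⇒≤; ≤⇒≯; n≮n)
open import Data.Product using (_,_; proj₁; proj₂)
open import Data.Sign using (Sign) renaming (_*_ to _·_)
open import Data.Sign.Properties
  using (*-assoc; *-comm; *-identityʳ; s*s≡+; *-commutativeMonoid; *-commutativeSemigroup)
open import Algebra.Properties.CommutativeSemigroup *-commutativeSemigroup using (interchange)
open import Data.Vec using ([]; _∷_; lookup)
open import Function using (_∘_)
open import Relation.Binary.Definitions using (DecidableEquality)
open import Relation.Binary.PropositionalEquality
  using (_≡_; _≢_; refl; sym; trans; cong; cong₂; subst; ≢-sym; module ≡-Reasoning)
open import Relation.Nullary.Decidable using (does; dec-true; dec-false)

private variable
  A B : Set

toSign : Bool → Sign
toSign true  = Sign.-
toSign false = Sign.+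

∏ : (A → Sign) → List A → Sign
∏ f xs = prodSign (map f xs)

∏< : (A → A → Sign) → List A → Sign
∏< f []       = Sign.+
∏< f (x ∷ xs) = ∏ (f x) xs · ∏< f xs

∏-cong : {f g : A → Sign} → (∀ x → f x ≡ g x) → (xs : List A) → ∏ f xs ≡ ∏ g xs
∏-cong f≗g xs = cong prodSign (map-cong f≗g xs)

∏-+ : {f : A → Sign} {xs : List A} → All (λ x → f x ≡ Sign.+) xs → ∏ f xs ≡ Sign.+
∏-+ []             = refl
∏-+ (fx≡+ ∷ fxs≡+) rewrite fx≡+ = ∏-+ fxs≡+

∏-· : (f g : A → Sign) (xs : List A) → ∏ (λ x → f x · g x) xs ≡ ∏ f xs · ∏ g xs
∏-· f g []       = refl
∏-· f g (x ∷ xs) =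
  trans (cong (f x · g x ·_) (∏-· f g xs)) (interchange (f x) (g x) (∏ f xs) (∏ g xs))

∏-const : (s : Sign) (xs : List A) → ∏ (λ _ → s) xs ≡ signPowS s (length xs)
∏-const s []       = refl
∏-const s (x ∷ xs) = cong (s ·_) (∏-const s xs)

∏-map : (f : B → Sign) (g : A → B) (xs : List A) → ∏ f (map g xs) ≡ ∏ (f ∘ g) xs
∏-map f g xs = cong prodSign (sym (map-∘ xs))

∏-filterᵇ : (f : A → Sign) (p : A → Bool) (xs : List A) →
  ∏ f (filterᵇ p xs) ≡ ∏ (λ x → if p x then f x else Sign.+) xs
∏-filterᵇ f p []       = refl
∏-filterᵇ f p (x ∷ xs) with p x
... | true  = cong (f x ·_) (∏-filterᵇ f p xs)
... | false = ∏-filterᵇ f p xs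

∏-swap : (f : A → B → Sign) (xs : List A) (ys : List B) →
  ∏ (λ x → ∏ (f x) ys) xs ≡ ∏ (λ y → ∏ (λ x → f x y) xs) ys
∏-swap f []       ys = sym (∏-+ (All.universal (λ _ → refl) ys))
∏-swap f (x ∷ xs) ys =
  trans (cong (∏ (f x) ys ·_) (∏-swap f xs ys)) (sym (∏-· (f x) _ ys))

∏-↭ : (f : A → Sign) {xs ys : List A} → xs ↭ ys → ∏ f xs ≡ ∏ f ys
∏-↭ f xs↭ys = foldr-commMonoid setoid isCommutativeMonoid (↭⇒↭ₛ (↭-map⁺ f xs↭ys))
  where open CommutativeMonoid *-commutativeMonoid

∏-δ : (_≟_ : DecidableEquality A) {xs : List A} {c : A} → Unique xs → c ∈ xs →
  (f : Bool → A → Sign) → (∀ a → f false a ≡ Sign.+) →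
  ∏ (λ a → f (does (c ≟ a)) a) xs ≡ f true c
∏-δ _≟_ {c = c} unique c∈xs f f-false = go unique c∈xs
  where
  off : ∀ {a} → c ≢ a → f (does (c ≟ a)) a ≡ Sign.+
  off {a} c≢a = trans (cong (λ b → f b a) (dec-false (c ≟ a) c≢a)) (f-false a)

  go : ∀ {xs} → Unique xs → c ∈ xs → ∏ (λ a → f (does (c ≟ a)) a) xs ≡ f true c
  go (c≢xs ∷ _) (here refl) rewrite dec-true (c ≟ c) refl =
    trans (cong (f true c ·_) (∏-+ (All.map off c≢xs))) (*-identityʳ (f true c))
  go (x≢xs ∷ unique) (there c∈xs) rewrite off (≢-sym (All.lookup x≢xs c∈xs)) =
    go unique c∈xs

∏-partition : {k : ℕ} (key : A → Fin k) (φ : Fin k → A → Sign) (xs : List A) →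
  ∏ (λ x → φ (key x) x) xs ≡
  ∏ (λ a → ∏ (φ a) (filterᵇ (λ x → does (key x ≟ a)) xs)) (allFin k)
∏-partition {k = k} key φ xs = begin
  ∏ (λ x → φ (key x) x) xs
    ≡⟨ ∏-cong (λ x → sym (∏-δ _≟_ (allFin⁺ k) (∈-allFin (key x))
                            (λ b a → if b then φ a x else Sign.+) (λ _ → refl))) xs ⟩
  ∏ (λ x → ∏ (λ a → if does (key x ≟ a) then φ a x else Sign.+) (allFin k)) xs
    ≡⟨ ∏-swap _ xs (allFin k) ⟩
  ∏ (λ a → ∏ (λ x → if does (key x ≟ a) then φ a x else Sign.+) xs) (allFin k)
    ≡⟨ ∏-cong (λ a → sym (∏-filterᵇ (φ a) _ xs)) (allFin k) ⟩
  ∏ (λ a → ∏ (φ a) (filterᵇ (λ x → does (key x ≟ a)) xs)) (allFin k) ∎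
  where open ≡-Reasoning

∏<-cong : {f g : A → A → Sign} → (∀ x y → f x y ≡ g x y) → (xs : List A) →
  ∏< f xs ≡ ∏< g xs
∏<-cong f≗g []       = refl
∏<-cong f≗g (x ∷ xs) = cong₂ _·_ (∏-cong (f≗g x) xs) (∏<-cong f≗g xs)

∏<-+ : {f : A → A → Sign} {xs : List A} → AllPairs (λ x y → f x y ≡ Sign.+) xs →
  ∏< f xs ≡ Sign.+
∏<-+ []             = refl
∏<-+ (fx≡+ ∷ fxs≡+) = cong₂ _·_ (∏-+ fx≡+) (∏<-+ fxs≡+)

∏<-· : (f g : A → A → Sign) (xs : List A) →
  ∏< (λ x y → f x y · g x y) xs ≡ ∏< f xs · ∏< g xs
∏<-· f g []       = refl
∏<-· f g (x ∷ xs) =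
  trans (cong₂ _·_ (∏-· (f x) (g x) xs) (∏<-· f g xs))
        (interchange (∏ (f x) xs) (∏ (g x) xs) (∏< f xs) (∏< g xs))

∏-∏< : (F : B → A → A → Sign) (js : List B) (xs : List A) →
  ∏ (λ j → ∏< (F j) xs) js ≡ ∏< (λ x y → ∏ (λ j → F j x y) js) xs
∏-∏< F js []       = ∏-+ (All.universal (λ _ → refl) js)
∏-∏< F js (x ∷ xs) =
  trans (∏-· (λ j → ∏ (F j x) xs) (λ j → ∏< (F j) xs) js)
        (cong₂ _·_ (∏-swap (λ j → F j x) js xs) (∏-∏< F js xs))

∏<-symmetric : (h : A → A → Sign) → (∀ x → h x x ≡ Sign.+) → (xs : List A) →
  ∏< (λ x y → h x y · h y x) xs ≡ ∏ (λ x → ∏ (h x) xs) xs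
∏<-symmetric h h-diag []       = refl
∏<-symmetric h h-diag (x ∷ xs) = begin
  ∏ (λ y → h x y · h y x) xs · ∏< (λ x y → h x y · h y x) xs
    ≡⟨ cong₂ _·_ (∏-· (h x) (λ y → h y x) xs) (∏<-symmetric h h-diag xs) ⟩
  (∏ (h x) xs · ∏ (λ y → h y x) xs) · ∏ (λ y → ∏ (h y) xs) xs
    ≡⟨ *-assoc (∏ (h x) xs) _ _ ⟩
  ∏ (h x) xs · (∏ (λ y → h y x) xs · ∏ (λ y → ∏ (h y) xs) xs)
    ≡⟨ cong₂ _·_ (cong (_· ∏ (h x) xs) (sym (h-diag x))) (sym (∏-· (λ y → h y x) _ xs)) ⟩
  (h x x · ∏ (h x) xs) · ∏ (λ y → h y x · ∏ (h y) xs) xs ∎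
  where open ≡-Reasoning

∏-cancel : (f g h : A → Sign) (s : Sign) (xs : List A) → (∀ x → f x · g x ≡ h x · s) →
  (signPowS s (length xs) · ∏ f xs) · ∏ g xs ≡ ∏ h xs
∏-cancel f g h s xs fg≡hs = begin
  (S · ∏ f xs) · ∏ g xs       ≡⟨ *-assoc S _ _ ⟩
  S · (∏ f xs · ∏ g xs)       ≡⟨ cong (S ·_) (sym (∏-· f g xs)) ⟩
  S · ∏ (λ x → f x · g x) xs  ≡⟨ cong (S ·_) (∏-cong fg≡hs xs) ⟩
  S · ∏ (λ x → h x · s) xs    ≡⟨ cong (S ·_) (trans (∏-· h _ xs) (cong (∏ h xs ·_) (∏-const s xs))) ⟩
  S · (∏ h xs · S)            ≡⟨ cong (S ·_) (*-comm (∏ h xs) S) ⟩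
  S · (S · ∏ h xs)            ≡⟨ sym (*-assoc S S _) ⟩
  (S · S) · ∏ h xs            ≡⟨ cong (_· ∏ h xs) (s*s≡+ S) ⟩
  ∏ h xs                      ∎
  where
  open ≡-Reasoning
  S : Sign
  S = signPowS s (length xs)

signPow-+ : ∀ m n → signPow (m + n) ≡ signPow m · signPow n
signPow-+ zero    n = refl
signPow-+ (suc m) n =
  trans (cong (Sign.- ·_) (signPow-+ m n)) (sym (*-assoc Sign.- (signPow m) (signPow n)))

signPow-length-filterᵇ : (p : A → Bool) (xs : List A) →
  signPow (length (filterᵇ p xs)) ≡ ∏ (toSign ∘ p) xs
signPow-length-filterᵇ p []       = refl
signPow-length-filterᵇ p (x ∷ xs) with p x
... | true  = cong (Sign.- ·_) (signPow-length-filterᵇ p xs)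
... | false = signPow-length-filterᵇ p xs

if-toSign : ∀ b c → (if b then toSign c else Sign.+) ≡ toSign (b ∧ c)
if-toSign true  c = refl
if-toSign false c = refl

msgn-map-filterᵇ : (g : A → ℕ) (p : A → Bool) (xs : List A) →
  msgn (map g (filterᵇ p xs)) ≡ ∏< (λ x y → toSign (p x ∧ (p y ∧ (g y <ᵇ g x)))) xs
msgn-map-filterᵇ g p []       = refl
msgn-map-filterᵇ g p (x ∷ xs) with p x
... | true  = begin
  signPow (length (filterᵇ (_<ᵇ g x) ys) + inversions ys)
    ≡⟨ signPow-+ (length (filterᵇ (_<ᵇ g x) ys)) (inversions ys) ⟩
  signPow (length (filterᵇ (_<ᵇ g x) ys)) · msgn ys
    ≡⟨ cong₂ _·_ (trans (signPow-length-filterᵇ (_<ᵇ g x) ys) smaller) (msgn-map-filterᵇ g p xs) ⟩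
  ∏ (λ y → toSign (p y ∧ (g y <ᵇ g x))) xs · ∏< _ xs ∎
  where
  open ≡-Reasoning
  ys : List ℕ
  ys = map g (filterᵇ p xs)
  smaller : ∏ (toSign ∘ (_<ᵇ g x)) ys ≡ ∏ (λ y → toSign (p y ∧ (g y <ᵇ g x))) xs
  smaller = trans (∏-map _ g (filterᵇ p xs))
                  (trans (∏-filterᵇ _ p xs) (∏-cong (λ y → if-toSign (p y) _) xs))
... | false =
  trans (msgn-map-filterᵇ g p xs) (cong (_· ∏< _ xs) (sym (∏-+ (All.universal (λ _ → refl) xs))))

filterᵇ-map : (p : B → Bool) (g : A → B) (xs : List A) →
  filterᵇ p (map g xs) ≡ map g (filterᵇ (p ∘ g) xs)
filterᵇ-map p g []       = refl
filterᵇ-map p g (x ∷ xs) with p (g x)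
... | true  = cong (g x ∷_) (filterᵇ-map p g xs)
... | false = filterᵇ-map p g xs

filterᵇ-filterᵇ : (p q : A → Bool) (xs : List A) →
  filterᵇ p (filterᵇ q xs) ≡ filterᵇ (λ x → q x ∧ p x) xs
filterᵇ-filterᵇ p q []       = refl
filterᵇ-filterᵇ p q (x ∷ xs) with q x
... | false = filterᵇ-filterᵇ p q xs
... | true with p x
...   | true  = cong (x ∷_) (filterᵇ-filterᵇ p q xs)
...   | false = filterᵇ-filterᵇ p q xs

filterᵇ-all : {p : A → Bool} {xs : List A} → All (λ x → p x ≡ true) xs → filterᵇ p xs ≡ xs
filterᵇ-all []                   = refl
filterᵇ-all {xs = x ∷ _} (px ∷ pxs) rewrite px = cong (x ∷_) (filterᵇ-all pxs)

filterᵇ-none : {p : A → Bool} {xs : List A} → All (λ x → p x ≡ false) xs → filterᵇ p xs ≡ []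
filterᵇ-none []                 = refl
filterᵇ-none (px ∷ pxs) rewrite px = filterᵇ-none pxs

∈-filterᵇ⁺ : (p : A → Bool) {x : A} {xs : List A} → x ∈ xs → p x ≡ true → x ∈ filterᵇ p xs
∈-filterᵇ⁺ p (here refl) px rewrite px = here refl
∈-filterᵇ⁺ p {xs = y ∷ _} (there x∈xs) px with p y
... | true  = there (∈-filterᵇ⁺ p x∈xs px)
... | false = ∈-filterᵇ⁺ p x∈xs px

allPairs-universal : {R : A → A → Set} → (∀ x y → R x y) → (xs : List A) → AllPairs R xs
allPairs-universal r []       = []
allPairs-universal r (x ∷ xs) = All.universal (r x) xs ∷ allPairs-universal r xs

coord : {k d : ℕ} → Fin d → Cell k d → ℕ
coord ℓ a = toℕ (lookup a ℓ)

does-≟-toℕ : {k : ℕ} (a b : Fin k) → does (a ≟ b) ≡ (toℕ a ≡ᵇ toℕ b)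
does-≟-toℕ Fin.zero    Fin.zero    = refl
does-≟-toℕ Fin.zero    (Fin.suc b) = refl
does-≟-toℕ (Fin.suc a) Fin.zero    = refl
does-≟-toℕ (Fin.suc a) (Fin.suc b) = does-≟-toℕ a b

∈-allCells : {k d : ℕ} (a : Cell k d) → a ∈ allCells k d
∈-allCells []      = here refl
∈-allCells (i ∷ a) = ∈-concat⁺′ (∈-map⁺ (i ∷_) (∈-allCells a)) (∈-map⁺ _ (∈-allFin i))

allCells-sorted : (k e : ℕ) →
  AllPairs (λ x y → coord Fin.zero x ≤ coord Fin.zero y) (allCells k (suc e))
allCells-sorted k e =
  AllPairs.concat⁺ (All.map⁺ (All.tabulate⁺ within))
                   (AllPairs.map⁺ (AllPairs.tabulate⁺-< across))
  where
  cells : List (Cell k e)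
  cells = allCells k e
  _≤₀_ : Cell k (suc e) → Cell k (suc e) → Set
  x ≤₀ y = coord Fin.zero x ≤ coord Fin.zero y
  within : (i : Fin k) → AllPairs _≤₀_ (map (i ∷_) cells)
  within i = AllPairs.map⁺ (allPairs-universal (λ _ _ → ≤-refl) cells)
  across : ∀ {i j : Fin k} → toℕ i < toℕ j → All (λ x → All (x ≤₀_) (map (j ∷_) cells)) (map (i ∷_) cells)
  across i<j = All.map⁺ (All.universal (λ _ → All.map⁺ (All.universal (λ _ → <⇒≤ i<j) cells)) cells)

laterDirs-suc : (e : ℕ) → laterDirs (suc e) ≡ tabulate Fin.suc
laterDirs-suc e = filterᵇ-all (All.tabulate⁺ (λ _ → refl))

length-laterDirs : (e : ℕ) → length (laterDirs (suc e)) ≡ e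
length-laterDirs e = trans (cong length (laterDirs-suc e)) (length-tabulate Fin.suc)

sgnFirst-sgnDir : {k e : ℕ} (C : Cell k (suc e) → ℕ) → sgnFirst C ≡ sgnDir C Fin.zero
sgnFirst-sgnDir {e = e} C =
  trans (cong (λ ds → prodSign (map (sgnDir C) (Fin.zero ∷ ds))) noLaterFirst) (*-identityʳ _)
  where
  noLaterFirst : filterᵇ (λ ℓ → toℕ ℓ ≡ᵇ 0) (tabulate {n = e} Fin.suc) ≡ []
  noLaterFirst = filterᵇ-none (All.tabulate⁺ {f = Fin.suc} (λ _ → refl))

-- The elementary signs of a pair of cells x before y, where p = C x, q = C y
-- and u, v are the coordinates of x and y in a fixed direction.
Weight : Set
Weight = ℕ → ℕ → ℕ → ℕ → Sign

sliceInversion : Weight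
sliceInversion p u q v = toSign (isNonzero p ∧ (((v ≡ᵇ u) ∧ isNonzero q) ∧ (q <ᵇ p)))

levelInversion : Weight
levelInversion p u q v = toSign (isNonzero p ∧ ((q ≡ᵇ p) ∧ (v <ᵇ u)))

coordInversion : Weight
coordInversion p u q v = toSign (isNonzero p ∧ (isNonzero q ∧ (v <ᵇ u)))

valueInversion : Weight
valueInversion p u q v = toSign (isNonzero p ∧ (isNonzero q ∧ (q <ᵇ p)))

discordant : ℕ → ℕ → ℕ → ℕ → Bool
discordant p u q v = isNonzero p ∧ (isNonzero q ∧ ((p <ᵇ q) ∧ (v <ᵇ u)))

discordance : Weight
discordance p u q v = toSign (discordant p u q v) · toSign (discordant q v p u)

discordant-irrefl : ∀ p u → discordant p u p u ≡ false
discordant-irrefl zero    u = refl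
discordant-irrefl (suc p) u rewrite dec-false (p <? p) (n≮n p) = refl

data Compareᵇ : (lt gt eq : Bool) → Set where
  less    : Compareᵇ true  false false
  equal   : Compareᵇ false false true
  greater : Compareᵇ false true  false

compareᵇ : ∀ m n → Compareᵇ (m <ᵇ n) (n <ᵇ m) (m ≡ᵇ n)
compareᵇ zero    zero    = equal
compareᵇ zero    (suc n) = less
compareᵇ (suc m) zero    = greater
compareᵇ (suc m) (suc n) = compareᵇ m n

weight-identity : ∀ p u q v →
  sliceInversion p u q v · levelInversion p u q v ≡
  coordInversion p u q v · (discordance p u q v · valueInversion p u q v)
weight-identity zero    u zero    v = refl
weight-identity zero    u (suc q) v = refl
weight-identity (suc p) u zero    v = cong (λ b → toSign (b ∧ true) · Sign.+) (∧-zeroʳ (v ≡ᵇ u))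
weight-identity (suc p) u (suc q) v = identityᵇ (compareᵇ q p) (compareᵇ v u)
  where
  -- lt, gt, eq compare q with p; lt′, gt′, eq′ compare v with u.
  identityᵇ : ∀ {lt gt eq lt′ gt′ eq′} → Compareᵇ lt gt eq → Compareᵇ lt′ gt′ eq′ →
    toSign ((eq′ ∧ true) ∧ lt) · toSign (eq ∧ lt′) ≡
    toSign lt′ · ((toSign (gt ∧ lt′) · toSign (lt ∧ gt′)) · toSign lt)
  identityᵇ less    less    = refl
  identityᵇ less    equal   = refl
  identityᵇ less    greater = refl
  identityᵇ equal   less    = refl
  identityᵇ equal   equal   = refl
  identityᵇ equal   greater = refl
  identityᵇ greater less    = refl
  identityᵇ greater equal   = refl
  identityᵇ greater greater = refl

coordInversion-≤ : ∀ p q {u v} → u ≤ v → coordInversion p u q v ≡ Sign.+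
coordInversion-≤ p q {u} {v} u≤v rewrite dec-false (v <? u) (≤⇒≯ u≤v)
                                       | ∧-zeroʳ (isNonzero q) | ∧-zeroʳ (isNonzero p) = refl

levelInversion-≤ : ∀ p q {u v} → u ≤ v → levelInversion p u q v ≡ Sign.+
levelInversion-≤ p q {u} {v} u≤v rewrite dec-false (v <? u) (≤⇒≯ u≤v)
                                       | ∧-zeroʳ (q ≡ᵇ p) | ∧-zeroʳ (isNonzero p) = refl

∏-level : ∀ {n} c q b → c ≤ n →
  ∏ (λ i → toSign ((c ≡ᵇ suc i) ∧ ((q ≡ᵇ suc i) ∧ b))) (upTo n) ≡
  toSign (isNonzero c ∧ ((q ≡ᵇ c) ∧ b))
∏-level {n} zero q b _ = ∏-+ {xs = upTo n} (All.universal (λ _ → refl) (upTo n))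
∏-level (suc c) q b c<n =
  ∏-δ ℕ._≟_ (upTo⁺ _) (∈-upTo⁺ c<n)
      (λ e i → toSign (e ∧ ((q ≡ᵇ suc i) ∧ b))) (λ _ → refl)

module _ {k d : ℕ} (C : Cell k d → ℕ) where

  private
    cells : List (Cell k d)
    cells = allCells k d

  pairWeight : Weight → Fin d → Cell k d → Cell k d → Sign
  pairWeight w ℓ x y = w (C x) (coord ℓ x) (C y) (coord ℓ y)

  pairProduct : Weight → Fin d → Sign
  pairProduct w ℓ = ∏< (pairWeight w ℓ) cells

  sgnDir-pairProduct : (ℓ : Fin d) → sgnDir C ℓ ≡ pairProduct sliceInversion ℓ
  sgnDir-pairProduct ℓ = begin
    sgnDir C ℓ
      ≡⟨ ∏-cong (λ j → trans (cong msgn (cPerm-≡ j)) (msgn-map-filterᵇ C _ cells)) (allFin k) ⟩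
    ∏ (λ j → ∏< (F j) cells) (allFin k)
      ≡⟨ ∏-∏< F (allFin k) cells ⟩
    ∏< (λ x y → ∏ (λ j → F j x y) (allFin k)) cells
      ≡⟨ ∏<-cong sameSlice cells ⟩
    pairProduct sliceInversion ℓ ∎
    where
    open ≡-Reasoning
    inSlice : Fin k → Cell k d → Bool
    inSlice j a = does (lookup a ℓ ≟ j) ∧ isNonzero (C a)
    F : Fin k → Cell k d → Cell k d → Sign
    F j x y = toSign (inSlice j x ∧ (inSlice j y ∧ (C y <ᵇ C x)))
    cPerm-≡ : ∀ j → cPerm C ℓ j ≡ map C (filterᵇ (inSlice j) cells)
    cPerm-≡ j = trans (filterᵇ-map isNonzero C (sliceCells ℓ j))
                      (cong (map C) (filterᵇ-filterᵇ _ _ cells))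
    sameSlice : ∀ x y → ∏ (λ j → F j x y) (allFin k) ≡ pairWeight sliceInversion ℓ x y
    sameSlice x y =
      trans (∏-δ _≟_ (allFin⁺ k) (∈-allFin (lookup x ℓ))
              (λ e j → toSign ((e ∧ isNonzero (C x)) ∧ (inSlice j y ∧ (C y <ᵇ C x)))) (λ _ → refl))
            (cong (λ b → toSign (isNonzero (C x) ∧ ((b ∧ isNonzero (C y)) ∧ (C y <ᵇ C x))))
                  (does-≟-toℕ (lookup y ℓ) (lookup x ℓ)))

  sgnT-pairProduct : (T : Subset k d) → (∀ a → isNonzero (C a) ≡ T a) →
    sgnT T ≡ ∏ (pairProduct coordInversion) (allFin d)
  sgnT-pairProduct T C≍T =
    ∏-cong (λ ℓ → trans (msgn-map-filterᵇ (coord ℓ) T cells) (∏<-cong (C≍T₂ ℓ) cells)) (allFin d)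
    where
    C≍T₂ : ∀ ℓ x y →
      toSign (T x ∧ (T y ∧ (coord ℓ y <ᵇ coord ℓ x))) ≡ pairWeight coordInversion ℓ x y
    C≍T₂ ℓ x y = cong₂ (λ a b → toSign (a ∧ (b ∧ _))) (sym (C≍T x)) (sym (C≍T y))

  ssgn-pairProduct : (n : ℕ) → (∀ a → C a ≤ n) →
    ssgn n C ≡ ∏ (pairProduct levelInversion) (laterDirs d)
  ssgn-pairProduct n C≤n = begin
    ssgn n C
      ≡⟨ ∏-cong (λ i → ∏-cong (λ m → msgn-map-filterᵇ (coord m) (λ a → C a ≡ᵇ suc i) cells) later)
                (upTo n) ⟩
    ∏ (λ i → ∏ (λ m → ∏< (G i m) cells) later) (upTo n)
      ≡⟨ ∏-swap _ (upTo n) later ⟩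
    ∏ (λ m → ∏ (λ i → ∏< (G i m) cells) (upTo n)) later
      ≡⟨ ∏-cong (λ m → trans (∏-∏< (λ i → G i m) (upTo n) cells)
                             (∏<-cong (λ x y → ∏-level (C x) (C y) _ (C≤n x)) cells)) later ⟩
    ∏ (pairProduct levelInversion) later ∎
    where
    open ≡-Reasoning
    later : List (Fin d)
    later = laterDirs d
    G : ℕ → Fin d → Cell k d → Cell k d → Sign
    G i m x y = toSign ((C x ≡ᵇ suc i) ∧ ((C y ≡ᵇ suc i) ∧ (coord m y <ᵇ coord m x)))

  sgnDir-·-levelInversions : (ℓ : Fin d) →
    sgnDir C ℓ · pairProduct levelInversion ℓ ≡
    pairProduct coordInversion ℓ · (pairProduct discordance ℓ · pairProduct valueInversion ℓ)
  sgnDir-·-levelInversions ℓ = begin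
    sgnDir C ℓ · pairProduct levelInversion ℓ
      ≡⟨ cong (_· pairProduct levelInversion ℓ) (sgnDir-pairProduct ℓ) ⟩
    pairProduct sliceInversion ℓ · pairProduct levelInversion ℓ
      ≡⟨ ∏<-· _ _ cells ⟨
    ∏< (λ x y → w sliceInversion x y · w levelInversion x y) cells
      ≡⟨ ∏<-cong (λ x y → weight-identity (C x) (coord ℓ x) (C y) (coord ℓ y)) cells ⟩
    ∏< (λ x y → w coordInversion x y · (w discordance x y · w valueInversion x y)) cells
      ≡⟨ trans (∏<-· _ _ cells) (cong (pairProduct coordInversion ℓ ·_) (∏<-· _ _ cells)) ⟩
    pairProduct coordInversion ℓ · (pairProduct discordance ℓ · pairProduct valueInversion ℓ) ∎
    where
    open ≡-Reasoning
    w : Weight → Cell k d → Cell k d → Sign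
    w v = pairWeight v ℓ

latinDiscordance : ℕ → ℕ → Sign
latinDiscordance k n =
  ∏ (λ a → ∏ (λ p → ∏ (λ b → ∏ (λ q → h p a q b) values) (allFin k)) values) (allFin k)
  where
  values : List ℕ
  values = map suc (upTo n)
  h : ℕ → Fin k → ℕ → Fin k → Sign
  h p a q b = toSign (discordant p (toℕ a) q (toℕ b))

module _ {k d n : ℕ} {T : Subset k d} {C : Cell k d → ℕ} (latin : IsPLH n T C) where

  private
    cells : List (Cell k d)
    cells = allCells k d
    values : List ℕ
    values = map suc (upTo n)

  ∏-slice-values : (ℓ : Fin d) (j : Fin k) (ψ : ℕ → Sign) → ψ 0 ≡ Sign.+ →
    ∏ (ψ ∘ C) (sliceCells ℓ j) ≡ ∏ ψ values
  ∏-slice-values ℓ j ψ ψ0≡+ = begin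
    ∏ (ψ ∘ C) (sliceCells ℓ j)                             ≡⟨ ∏-map ψ C (sliceCells ℓ j) ⟨
    ∏ ψ entries                                            ≡⟨ ∏-cong dropZero entries ⟨
    ∏ (λ p → if isNonzero p then ψ p else Sign.+) entries  ≡⟨ ∏-filterᵇ ψ isNonzero entries ⟨
    ∏ ψ (cPerm C ℓ j)                                      ≡⟨ ∏-↭ ψ (proj₂ latin ℓ j) ⟩
    ∏ ψ values                                             ∎
    where
    open ≡-Reasoning
    entries : List ℕ
    entries = map C (sliceCells ℓ j)
    dropZero : ∀ p → (if isNonzero p then ψ p else Sign.+) ≡ ψ p
    dropZero zero    = sym ψ0≡+
    dropZero (suc p) = refl

  entry∈values : (ℓ : Fin d) (a : Cell k d) → isNonzero (C a) ≡ true → C a ∈ values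
  entry∈values ℓ a Ca≢0 =
    ∈-resp-↭ (proj₂ latin ℓ (lookup a ℓ)) (∈-filterᵇ⁺ isNonzero (∈-map⁺ C a∈slice) Ca≢0)
    where
    a∈slice : a ∈ sliceCells ℓ (lookup a ℓ)
    a∈slice = ∈-filterᵇ⁺ _ (∈-allCells a) (dec-true (lookup a ℓ ≟ lookup a ℓ) refl)

  entry-≤ : Fin d → (a : Cell k d) → C a ≤ n
  entry-≤ ℓ a with C a in Ca≡
  ... | zero  = z≤n
  ... | suc c with ∈-map⁻ suc (subst (_∈ values) Ca≡ (entry∈values ℓ a (cong isNonzero Ca≡)))
  ...   | _ , c∈upTo , refl = ∈-upTo⁻ c∈upTo

  -- Group the pairs (x, y) by the ℓ-slices of x and of y; within a slice the
  -- Latin property turns the entries into the list 1, …, n.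
  discordance-closedForm : (ℓ : Fin d) → pairProduct C discordance ℓ ≡ latinDiscordance k n
  discordance-closedForm ℓ = begin
    pairProduct C discordance ℓ
      ≡⟨ ∏<-symmetric (λ x y → h (C x) (coord ℓ x) (C y) (coord ℓ y))
                      (λ x → cong toSign (discordant-irrefl (C x) (coord ℓ x))) cells ⟩
    ∏ (λ x → ∏ (λ y → h (C x) (coord ℓ x) (C y) (coord ℓ y)) cells) cells
      ≡⟨ ∏-partition (λ x → lookup x ℓ) (λ a x → ∏ (λ y → h (C x) (toℕ a) (C y) (coord ℓ y)) cells)
                     cells ⟩
    slices (λ a x → ∏ (λ y → h (C x) (toℕ a) (C y) (coord ℓ y)) cells)
      ≡⟨ ∏-cong (λ a → ∏-cong (λ x → ∏-partition (λ y → lookup y ℓ) (hᵃ a x) cells)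
                              (sliceCells ℓ a)) (allFin k) ⟩
    slices (λ a x → slices (hᵃ a x))
      ≡⟨ ∏-cong (λ a → ∏-cong (λ x → ∏-cong (λ b → ∏-slice-values ℓ b _ (h-zeroʳ (C x) (toℕ a) (toℕ b)))
                                            (allFin k))
                              (sliceCells ℓ a)) (allFin k) ⟩
    slices (λ a x → ∏ (λ b → ∏ (λ q → h (C x) (toℕ a) q (toℕ b)) values) (allFin k))
      ≡⟨ ∏-cong (λ a → ∏-slice-values ℓ a _ (∏h-zeroˡ (toℕ a))) (allFin k) ⟩
    latinDiscordance k n ∎
    where
    open ≡-Reasoning
    h : ℕ → ℕ → ℕ → ℕ → Sign
    h p u q v = toSign (discordant p u q v)
    hᵃ : Fin k → Cell k d → Fin k → Cell k d → Sign
    hᵃ a x b y = h (C x) (toℕ a) (C y) (toℕ b)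
    slices : (Fin k → Cell k d → Sign) → Sign
    slices φ = ∏ (λ a → ∏ (φ a) (sliceCells ℓ a)) (allFin k)
    h-zeroʳ : ∀ p u v → h p u 0 v ≡ Sign.+
    h-zeroʳ p u v = cong toSign (∧-zeroʳ (isNonzero p))
    ∏h-zeroˡ : ∀ u → ∏ (λ b → ∏ (λ q → h 0 u q (toℕ b)) values) (allFin k) ≡ Sign.+
    ∏h-zeroˡ u = ∏-+ (All.universal (λ _ → ∏-+ (All.universal (λ _ → refl) values)) (allFin k))

module _ {e k n : ℕ} {T : Subset k (suc e)} {C : Cell k (suc e) → ℕ} (latin : IsPLH n T C) where

  firstSign : Sign
  firstSign = pairProduct C discordance Fin.zero · pairProduct C valueInversion Fin.zero

  firstInversions-+ : pairProduct C coordInversion Fin.zero ≡ Sign.+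
  firstInversions-+ = ∏<-+ (AllPairs.map (λ {x} {y} → coordInversion-≤ (C x) (C y)) (allCells-sorted k e))

  firstLevelInversions-+ : pairProduct C levelInversion Fin.zero ≡ Sign.+
  firstLevelInversions-+ = ∏<-+ (AllPairs.map (λ {x} {y} → levelInversion-≤ (C x) (C y)) (allCells-sorted k e))

  sgnDir-·-levelInversions-latin : (ℓ : Fin (suc e)) →
    sgnDir C ℓ · pairProduct C levelInversion ℓ ≡ pairProduct C coordInversion ℓ · firstSign
  sgnDir-·-levelInversions-latin ℓ =
    trans (sgnDir-·-levelInversions C ℓ)
          (cong (λ s → pairProduct C coordInversion ℓ · (s · pairProduct C valueInversion ℓ))
                (trans (discordance-closedForm latin ℓ) (sym (discordance-closedForm latin Fin.zero))))

  sgnFirst-≡ : sgnFirst C ≡ firstSign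
  sgnFirst-≡ = begin
    sgnFirst C                                         ≡⟨ sgnFirst-sgnDir C ⟩
    sgnDir C Fin.zero                                  ≡⟨ *-identityʳ _ ⟨
    sgnDir C Fin.zero · Sign.+                         ≡⟨ cong (sgnDir C Fin.zero ·_) firstLevelInversions-+ ⟨
    sgnDir C Fin.zero · pairProduct C levelInversion Fin.zero
                                                       ≡⟨ sgnDir-·-levelInversions-latin Fin.zero ⟩
    pairProduct C coordInversion Fin.zero · firstSign  ≡⟨ cong (_· firstSign) firstInversions-+ ⟩
    firstSign                                          ∎
    where open ≡-Reasoning

  sgnT-laterDirs : sgnT T ≡ ∏ (pairProduct C coordInversion) (laterDirs (suc e))
  sgnT-laterDirs = begin
    sgnT T
      ≡⟨ sgnT-pairProduct C T (proj₁ latin) ⟩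
    pairProduct C coordInversion Fin.zero · ∏ (pairProduct C coordInversion) (tabulate Fin.suc)
      ≡⟨ cong₂ (λ s ds → s · ∏ (pairProduct C coordInversion) ds)
               firstInversions-+ (sym (laterDirs-suc e)) ⟩
    ∏ (pairProduct C coordInversion) (laterDirs (suc e)) ∎
    where open ≡-Reasoning

theorem7p12 : (d k n : ℕ) → 2 < d → 0 < k → 0 < n →
    (T : Subset k d) → IsMagic n T → card T ≡ n * k →
    (C : Cell k d → ℕ) → IsPLH n T C →
    (signPowS (sgnFirst C) (d ∸ 1) · prodSign (map (sgnDir C) (laterDirs d))) · ssgn n C
      ≡ sgnT T
theorem7p12 (suc e) k n _ _ _ T _ _ C latin = begin
  (signPowS (sgnFirst C) e · sgnDirs) · ssgn n C
    ≡⟨ cong₂ (λ s t → (signPowS s e · sgnDirs) · t)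
             (sgnFirst-≡ latin) (ssgn-pairProduct C n (entry-≤ latin Fin.zero)) ⟩
  (signPowS (firstSign latin) e · sgnDirs) · levelSigns
    ≡⟨ cong (λ l → (signPowS (firstSign latin) l · sgnDirs) · levelSigns) (length-laterDirs e) ⟨
  (signPowS (firstSign latin) (length later) · sgnDirs) · levelSigns
    ≡⟨ ∏-cancel (sgnDir C) (pairProduct C levelInversion) (pairProduct C coordInversion)
                (firstSign latin) later (sgnDir-·-levelInversions-latin latin) ⟩
  ∏ (pairProduct C coordInversion) later
    ≡⟨ sgnT-laterDirs latin ⟨
  sgnT T ∎
  where
  open ≡-Reasoning
  later : List (Fin (suc e))
  later = laterDirs (suc e)
  sgnDirs levelSigns : Sign
  sgnDirs = ∏ (sgnDir C) later
  levelSigns = ∏ (pairProduct C levelInversion) later
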